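{- (Completeness.) Let $\Phi$ be a logic program and $A$ an atomic formula. If $n:[\forall\underline{x}].\ \Rightarrow A$ is derivable given axioms $\Phi$, where $n$ is a proof term in normal form, then $\Phi\vdash\{A\}\leadsto^*_\gamma\emptyset$ for some substitution $\gamma$.
   Context: First-order terms $t ::= x \mid f(t_1,\dots,t_n)$; atomic formulas $P(t_1,\dots,t_n)$; Horn formulas $[\forall \underline{x}].\ A_1,\dots,A_n \Rightarrow A$ ($n\ge0$; for $n=0$ written $\Rightarrow A$), $\forall\underline{x}$ quantifying all free term variables, $[\forall\underline{x}].F$ meaning $F$ or $\forall\underline{x}.F$. Proof terms $p,e ::= \kappa \mid a \mid \lambda a.e \mid e\ e'$, normal form w.r.t. beta-reduction $(\lambda a.p)p'\to[p'/a]p$. A logic program $\Phi$ is a list of closed Horn formulas labelled by distinct proof-term constants. Typing given $\Phi$: (axiom) $\kappa:\forall\underline{x}.F$ if $(\kappa:\forall\underline{x}.F)\in\Phi$; (gen) $e:F\Rightarrow e:\forall\underline{x}.F$; (inst) $e:\forall\underline{x}.F\Rightarrow e:[\underline{t}/\underline{x}]F$; (cut) from $e_1:\underline{A}\Rightarrow D$ and $e_2:\underline{B},D\Rightarrow C$ infer $\lambda\underline{a}.\lambda\underline{b}.(e_2\ \underline{b})(e_1\ \underline{a}):\underline{A},\underline{B}\Rightarrow C$ with fresh proof-variable lists $\underline{a},\underline{b}$ of the lengths of $\underline{A},\underline{B}$. LP-Unif reduction: $\Phi\vdash\{A_1,\dots,A_i,\dots,A_n\}\leadsto_{\kappa,\gamma\cdot\gamma'}\{\gamma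 A_1,\dots,\gamma B_1,\dots,\gamma B_m,\dots,\gamma A_n\}$ (current state $\gamma'$) if $\kappa:\forall\underline{x}.B_1,\dots,B_m\Rightarrow C\in\Phi$ (variables renamed apart) and $\gamma$ is a most general unifier of $C$ and $A_i$; $\leadsto^*_\gamma$ is a finite sequence of such steps from the empty substitution with final state $\gamma$. -}

module Defs where

open import Data.Nat using (ℕ)
open import Data.List using (List; []; _∷_; _++_; map; length; concatMap)
open import Data.List.Membership.Propositional using (_∈_; _∉_)
open import Data.List.Relation.Unary.Unique.Propositional using (Unique)
open import Data.List.Relation.Unary.All using (All)
open import Data.Product using (_×_; _,_; Σ; ∃; proj₁)
open import Relation.Binary.PropositionalEquality using (_≡_)
open import Relation.Nullary using (¬_)
open import Data.Unit using (⊤)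
open import Data.Empty using (⊥)

data Term : Set where
  var : ℕ → Term
  fun : ℕ → List Term → Term

data Atom : Set where
  atom : ℕ → List Term → Atom

record Horn : Set where
  constructor _⇒_
  field
    body : List Atom
    head : Atom
open Horn public

-- [∀x̲].F : either F itself, or its universal closure ∀x̲.F
data Formula : Set where
  plain  : Horn → Formula
  closed : Horn → Formula

Subst : Set
Subst = ℕ → Term

mutual
  subT : Subst → Term → Term
  subT σ (var x)    = σ x
  subT σ (fun f ts) = fun f (subTs σ ts)

  subTs : Subst → List Term → List Term
  subTs σ []       = []
  subTs σ (t ∷ ts) = subT σ t ∷ subTs σ ts

subA : Subst → Atom → Atom
subA σ (atom P ts) = atom P (subTs σ ts)

subAs : Subst → List Atom → List Atom
subAs σ = map (subA σ)

subH : Subst → Horn → Horn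
subH σ (As ⇒ A) = subAs σ As ⇒ subA σ A

ε : Subst
ε = var

-- composition γ · γ' : first γ', then γ
_·_ : Subst → Subst → Subst
(γ · γ') x = subT γ (γ' x)

Unifies : Subst → Atom → Atom → Set
Unifies γ A B = subA γ A ≡ subA γ B

MGU : Subst → Atom → Atom → Set
MGU γ A B = Unifies γ A B ×
  ((δ : Subst) → Unifies δ A B → Σ Subst λ θ → (x : ℕ) → δ x ≡ subT θ (γ x))

mutual
  varsT : Term → List ℕ
  varsT (var x)    = x ∷ []
  varsT (fun f ts) = varsTs ts

  varsTs : List Term → List ℕ
  varsTs []       = []
  varsTs (t ∷ ts) = varsT t ++ varsTs ts

varsA : Atom → List ℕ
varsA (atom P ts) = varsTs ts

varsAs : List Atom → List ℕ
varsAs = concatMap varsA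

varsH : Horn → List ℕ
varsH (As ⇒ A) = varsAs As ++ varsA A

-- Logic programs: lists of closed Horn formulas ∀x̲.F (stored as F,
-- implicitly universally closed) labelled by distinct constants κ ∈ ℕ.

Program : Set
Program = List (ℕ × Horn)

DistinctLabels : Program → Set
DistinctLabels Φ = Unique (map proj₁ Φ)

data PTerm : Set where
  κ   : ℕ → PTerm
  pv  : ℕ → PTerm
  ƛ   : ℕ → PTerm → PTerm
  _∙_ : PTerm → PTerm → PTerm

infixl 9 _∙_

data FreeIn (a : ℕ) : PTerm → Set where
  fv   : FreeIn a (pv a)
  fλ   : ∀ {b e} → ¬ (a ≡ b) → FreeIn a e → FreeIn a (ƛ b e)
  f∙ˡ  : ∀ {e e'} → FreeIn a e → FreeIn a (e ∙ e')
  f∙ʳ  : ∀ {e e'} → FreeIn a e' → FreeIn a (e ∙ e')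

IsLam : PTerm → Set
IsLam (ƛ _ _) = ⊤
IsLam _       = ⊥

data Normal : PTerm → Set where
  nκ : ∀ {c} → Normal (κ c)
  nv : ∀ {a} → Normal (pv a)
  nλ : ∀ {a e} → Normal e → Normal (ƛ a e)
  n∙ : ∀ {e e'} → ¬ IsLam e → Normal e → Normal e' → Normal (e ∙ e')

lams : List ℕ → PTerm → PTerm
lams []       e = e
lams (a ∷ as) e = ƛ a (lams as e)

apps : PTerm → List ℕ → PTerm
apps e []       = e
apps e (a ∷ as) = apps (e ∙ pv a) as

Fresh : List ℕ → List ℕ → PTerm → PTerm → Set
Fresh as bs e₁ e₂ =
  Unique (as ++ bs) ×
  All (λ a → ¬ FreeIn a e₁ × ¬ FreeIn a e₂) (as ++ bs)

data _⊢_∶_ (Φ : Program) : PTerm → Formula → Set where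
  axiom : ∀ {c F} → (c , F) ∈ Φ → Φ ⊢ κ c ∶ closed F
  gen   : ∀ {e F} → Φ ⊢ e ∶ plain F → Φ ⊢ e ∶ closed F
  inst  : ∀ {e F} (σ : Subst) → Φ ⊢ e ∶ closed F → Φ ⊢ e ∶ plain (subH σ F)
  cut   : ∀ {e₁ e₂ As Bs D C} (as bs : List ℕ) →
          length as ≡ length As → length bs ≡ length Bs →
          Fresh as bs e₁ e₂ →
          Φ ⊢ e₁ ∶ plain (As ⇒ D) →
          Φ ⊢ e₂ ∶ plain ((Bs ++ D ∷ []) ⇒ C) →
          Φ ⊢ lams as (lams bs (apps e₂ bs ∙ apps e₁ as)) ∶ plain ((As ++ Bs) ⇒ C)

Injective : (ℕ → ℕ) → Set
Injective ρ = ∀ x y → ρ x ≡ ρ y → x ≡ y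

RenamedApart : (ℕ → ℕ) → Horn → List Atom → Set
RenamedApart ρ F G = Injective ρ × All (λ x → ρ x ∉ varsAs G) (varsH F)

ren : (ℕ → ℕ) → Subst
ren ρ x = var (ρ x)

-- one step  Φ ⊢ G ↝_{κ, γ·γ'} G'   with current state γ'
data Step (Φ : Program) : List Atom → Subst → List Atom → Subst → Set where
  step : ∀ {c Bs C} (G₁ G₂ : List Atom) (Ai : Atom) (γ' γ : Subst) (ρ : ℕ → ℕ) →
         (c , (Bs ⇒ C)) ∈ Φ →
         RenamedApart ρ (Bs ⇒ C) (G₁ ++ Ai ∷ G₂) →
         MGU γ (subA (ren ρ) C) Ai →
         Step Φ (G₁ ++ Ai ∷ G₂) γ'
                (subAs γ (G₁ ++ subAs (ren ρ) Bs ++ G₂)) (γ · γ')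

data Steps (Φ : Program) : List Atom → Subst → List Atom → Subst → Set where
  done : ∀ {G γ} → Steps Φ G γ G γ
  more : ∀ {G γ G' γ' G'' γ''} → Step Φ G γ G' γ' → Steps Φ G' γ' G'' γ'' →
         Steps Φ G γ G'' γ''

_⊢_↝*[_]_ : Program → List Atom → Subst → List Atom → Set
Φ ⊢ G ↝*[ γ ] G' = Steps Φ G ε G' γ

-- A typing n : ⇒ A is sound for the instance reading of Horn clauses: it yields a finite
-- tree of substitution instances of program clauses whose root is an instance of A.
-- Such a tree is lifted to an LP-Unif refutation of {A} one node at a time (the lifting
-- lemma of SLD resolution). If the root of the tree for the selected goal uses clause
-- B̲ ⇒ C under θ, and δ is the instance chosen for the goals, then θ and δ glued on
-- disjoint variables unify the renamed-apart head C with the goal. Hence a most general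
-- unifier γ exists, the glued substitution factors through γ, and the resolvent again
-- has an instance derived by the remaining trees, which have fewer nodes in total.

module Submission where

open import Defs
open import Data.Nat using (ℕ; suc; _+_; _≤_; _<_; _∸_; s≤s; z≤n; _≟_; _<?_)
open import Data.Nat.Properties
open import Data.Nat.Tactic.RingSolver using (solve-∀)
open import Data.List using (List; []; _∷_; _++_)
open import Data.List.Properties using (∷-injective; map-++)
open import Data.List.Extrema.Nat using (max; xs≤max)
open import Data.List.Membership.Propositional using (_∈_; _∉_)
open import Data.List.Membership.Propositional.Properties using (∈-++⁺ˡ; ∈-++⁺ʳ; ∈-++⁻)
open import Data.List.Membership.DecPropositional _≟_ using (_∈?_)
open import Data.List.Relation.Unary.Any using (here)
open import Data.List.Relation.Unary.All as All using (All; []; _∷_)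
open import Data.List.Relation.Unary.All.Properties using (++⁺; ++⁻)
open import Data.Product using (_×_; _,_; Σ; Σ-syntax; proj₁; proj₂; map₂)
open import Data.Sum using (inj₁; inj₂; _⊎_; [_,_]′)
open import Data.Empty using (⊥-elim)
open import Relation.Nullary using (yes; no)
open import Relation.Binary.PropositionalEquality
open ≡-Reasoning

mutual
  subT-∘ : ∀ σ τ t → subT σ (subT τ t) ≡ subT (σ · τ) t
  subT-∘ σ τ (var x)    = refl
  subT-∘ σ τ (fun f ts) = cong (fun f) (subTs-∘ σ τ ts)

  subTs-∘ : ∀ σ τ ts → subTs σ (subTs τ ts) ≡ subTs (σ · τ) ts
  subTs-∘ σ τ []       = refl
  subTs-∘ σ τ (t ∷ ts) = cong₂ _∷_ (subT-∘ σ τ t) (subTs-∘ σ τ ts)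

mutual
  subT-cong-vars : ∀ σ τ t → (∀ x → x ∈ varsT t → σ x ≡ τ x) → subT σ t ≡ subT τ t
  subT-cong-vars σ τ (var x)    agree = agree x (here refl)
  subT-cong-vars σ τ (fun f ts) agree = cong (fun f) (subTs-cong-vars σ τ ts agree)

  subTs-cong-vars : ∀ σ τ ts → (∀ x → x ∈ varsTs ts → σ x ≡ τ x) → subTs σ ts ≡ subTs τ ts
  subTs-cong-vars σ τ []       agree = refl
  subTs-cong-vars σ τ (t ∷ ts) agree =
    cong₂ _∷_ (subT-cong-vars σ τ t (λ x x∈ → agree x (∈-++⁺ˡ x∈)))
              (subTs-cong-vars σ τ ts (λ x x∈ → agree x (∈-++⁺ʳ (varsT t) x∈)))

subT-cong : ∀ σ τ t → (∀ x → σ x ≡ τ x) → subT σ t ≡ subT τ t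
subT-cong σ τ t agree = subT-cong-vars σ τ t (λ x _ → agree x)

mutual
  subT-ε : ∀ t → subT ε t ≡ t
  subT-ε (var x)    = refl
  subT-ε (fun f ts) = cong (fun f) (subTs-ε ts)

  subTs-ε : ∀ ts → subTs ε ts ≡ ts
  subTs-ε []       = refl
  subTs-ε (t ∷ ts) = cong₂ _∷_ (subT-ε t) (subTs-ε ts)

fun-injective : ∀ {f g ss ts} → fun f ss ≡ fun g ts → f ≡ g × ss ≡ ts
fun-injective refl = refl , refl

subA-∘ : ∀ σ τ A → subA σ (subA τ A) ≡ subA (σ · τ) A
subA-∘ σ τ (atom P ts) = cong (atom P) (subTs-∘ σ τ ts)

subAs-∘ : ∀ σ τ As → subAs σ (subAs τ As) ≡ subAs (σ · τ) As
subAs-∘ σ τ []       = refl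
subAs-∘ σ τ (A ∷ As) = cong₂ _∷_ (subA-∘ σ τ A) (subAs-∘ σ τ As)

subA-cong-vars : ∀ σ τ A → (∀ x → x ∈ varsA A → σ x ≡ τ x) → subA σ A ≡ subA τ A
subA-cong-vars σ τ (atom P ts) agree = cong (atom P) (subTs-cong-vars σ τ ts agree)

subAs-cong-vars : ∀ σ τ As → (∀ x → x ∈ varsAs As → σ x ≡ τ x) → subAs σ As ≡ subAs τ As
subAs-cong-vars σ τ []       agree = refl
subAs-cong-vars σ τ (A ∷ As) agree =
  cong₂ _∷_ (subA-cong-vars σ τ A (λ x x∈ → agree x (∈-++⁺ˡ x∈)))
            (subAs-cong-vars σ τ As (λ x x∈ → agree x (∈-++⁺ʳ (varsA A) x∈)))

subA-cong : ∀ σ τ A → (∀ x → σ x ≡ τ x) → subA σ A ≡ subA τ A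
subA-cong σ τ A agree = subA-cong-vars σ τ A (λ x _ → agree x)

subAs-cong : ∀ σ τ As → (∀ x → σ x ≡ τ x) → subAs σ As ≡ subAs τ As
subAs-cong σ τ As agree = subAs-cong-vars σ τ As (λ x _ → agree x)

mutual
  size : Term → ℕ
  size (var x)    = 1
  size (fun f ts) = suc (sizes ts)

  sizes : List Term → ℕ
  sizes []       = 0
  sizes (t ∷ ts) = suc (size t + sizes ts)

size-pos : ∀ t → 1 ≤ size t
size-pos (var x)    = s≤s z≤n
size-pos (fun f ts) = s≤s z≤n

mutual
  size-var≤ : ∀ δ {x} t → x ∈ varsT t → size (δ x) ≤ size (subT δ t)
  size-var≤ δ (var _)    (here refl) = ≤-refl
  size-var≤ δ (fun f ts) x∈          = <⇒≤ (m<n⇒m<1+n (sizes-var< δ ts x∈))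

  sizes-var< : ∀ δ {x} ts → x ∈ varsTs ts → size (δ x) < sizes (subTs δ ts)
  sizes-var< δ (t ∷ ts) x∈ with ∈-++⁻ (varsT t) x∈
  ... | inj₁ x∈t  = s≤s (≤-trans (size-var≤ δ t x∈t) (m≤m+n _ _))
  ... | inj₂ x∈ts = s≤s (≤-trans (<⇒≤ (sizes-var< δ ts x∈ts)) (m≤n+m _ _))

occurs-check : ∀ δ {x} t → x ∈ varsT t → δ x ≡ subT δ t → t ≡ var x
occurs-check δ (var _)    (here refl) _ = refl
occurs-check δ (fun f ts) x∈ δx≡δt =
  ⊥-elim (<-irrefl (cong size δx≡δt) (m<n⇒m<1+n (sizes-var< δ ts x∈)))

Equation : Set
Equation = Term × Term

Solves : Subst → Equation → Set
Solves σ (s , t) = subT σ s ≡ subT σ t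

Unifier : Subst → List Equation → Set
Unifier σ = All (Solves σ)

Absorbs : Subst → Subst → Set
Absorbs δ σ = ∀ x → subT δ (σ x) ≡ δ x

absorbs-subT : ∀ {δ σ} → Absorbs δ σ → ∀ t → subT δ (subT σ t) ≡ subT δ t
absorbs-subT {δ} {σ} δσ≡δ t = trans (subT-∘ δ σ t) (subT-cong (δ · σ) δ t δσ≡δ)

-- Stronger than a plain mgu: every unifier δ is an instance of γ via δ itself.
IsMostGeneralUnifier : Subst → List Equation → Set
IsMostGeneralUnifier γ P = Unifier γ P × (∀ δ → Unifier δ P → Absorbs δ γ)

MostGeneralUnifier : List Equation → Set
MostGeneralUnifier P = Σ Subst (λ γ → IsMostGeneralUnifier γ P)

subP : Subst → List Equation → List Equation
subP σ []             = []
subP σ ((s , t) ∷ P) = (subT σ s , subT σ t) ∷ subP σ P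

unifier-subP : ∀ {δ σ} → Absorbs δ σ → ∀ P → Unifier δ P → Unifier δ (subP σ P)
unifier-subP δσ≡δ []             []       = []
unifier-subP δσ≡δ ((s , t) ∷ P) (e ∷ u) =
  trans (absorbs-subT δσ≡δ s) (trans e (sym (absorbs-subT δσ≡δ t))) ∷ unifier-subP δσ≡δ P u

unifier-∘ : ∀ γ σ P → Unifier γ (subP σ P) → Unifier (γ · σ) P
unifier-∘ γ σ []             []       = []
unifier-∘ γ σ ((s , t) ∷ P) (e ∷ u) =
  trans (sym (subT-∘ γ σ s)) (trans e (subT-∘ γ σ t)) ∷ unifier-∘ γ σ P u

_↦_ : ℕ → Term → Subst
(x ↦ t) y with x ≟ y
... | yes _ = t
... | no  _ = var y

↦-self : ∀ x t → (x ↦ t) x ≡ t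
↦-self x t with x ≟ x
... | yes _  = refl
... | no x≢x = ⊥-elim (x≢x refl)

↦-fresh : ∀ {x} t → x ∉ varsT t → subT (x ↦ t) t ≡ t
↦-fresh {x} t x∉t = trans (subT-cong-vars (x ↦ t) ε t untouched) (subT-ε t)
  where
    untouched : ∀ y → y ∈ varsT t → (x ↦ t) y ≡ var y
    untouched y y∈t with x ≟ y
    ... | yes refl = ⊥-elim (x∉t y∈t)
    ... | no  _    = refl

absorbs-↦ : ∀ {δ x t} → δ x ≡ subT δ t → Absorbs δ (x ↦ t)
absorbs-↦ {x = x} δx≡δt y with x ≟ y
... | yes refl = sym δx≡δt
... | no  _    = refl

mgu-[] : MostGeneralUnifier []
mgu-[] = ε , [] , λ _ _ _ → refl

mgu-trivial : ∀ t {P} → MostGeneralUnifier P → MostGeneralUnifier ((t , t) ∷ P)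
mgu-trivial t (γ , u , mg) = γ , refl ∷ u , λ { δ (_ ∷ uδ) → mg δ uδ }

mgu-swap : ∀ {s t P} → MostGeneralUnifier ((t , s) ∷ P) → MostGeneralUnifier ((s , t) ∷ P)
mgu-swap (γ , e ∷ u , mg) = γ , sym e ∷ u , λ { δ (eδ ∷ uδ) → mg δ (sym eδ ∷ uδ) }

mgu-decompose : ∀ {f s t ss ts P} →
  MostGeneralUnifier ((s , t) ∷ (fun f ss , fun f ts) ∷ P) →
  MostGeneralUnifier ((fun f (s ∷ ss) , fun f (t ∷ ts)) ∷ P)
mgu-decompose {f} (γ , e ∷ es ∷ u , mg) =
  γ , cong (fun f) (cong₂ _∷_ e (proj₂ (fun-injective es))) ∷ u ,
  λ { δ (eδ ∷ uδ) → let (e₁ , e₂) = ∷-injective (proj₂ (fun-injective eδ))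
                     in mg δ (e₁ ∷ cong (fun f) e₂ ∷ uδ) }

mgu-eliminate : ∀ {x t P} → x ∉ varsT t →
  MostGeneralUnifier (subP (x ↦ t) P) → MostGeneralUnifier ((var x , t) ∷ P)
mgu-eliminate {x} {t} {P} x∉t (γ , u , mg) =
  γ · (x ↦ t) , solves ∷ unifier-∘ γ (x ↦ t) P u , most-general
  where
    solves : subT γ ((x ↦ t) x) ≡ subT (γ · (x ↦ t)) t
    solves = begin
      subT γ ((x ↦ t) x)         ≡⟨ cong (subT γ) (↦-self x t) ⟩
      subT γ t                   ≡⟨ cong (subT γ) (↦-fresh t x∉t) ⟨
      subT γ (subT (x ↦ t) t)    ≡⟨ subT-∘ γ (x ↦ t) t ⟩
      subT (γ · (x ↦ t)) t       ∎

    most-general : ∀ δ → Unifier δ ((var x , t) ∷ P) → Absorbs δ (γ · (x ↦ t))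
    most-general δ (δx≡δt ∷ uδ) y = begin
      subT δ (subT γ ((x ↦ t) y))  ≡⟨ subT-∘ δ γ ((x ↦ t) y) ⟩
      subT (δ · γ) ((x ↦ t) y)     ≡⟨ subT-cong (δ · γ) δ ((x ↦ t) y) (mg δ (unifier-subP δ↦ P uδ)) ⟩
      subT δ ((x ↦ t) y)           ≡⟨ δ↦ y ⟩
      δ y                          ∎
      where δ↦ = absorbs-↦ δx≡δt

weight : Subst → List Equation → ℕ
weight δ []             = 0
weight δ ((s , t) ∷ P) = size (subT δ s) + size (subT δ t) + weight δ P

weight-subP : ∀ {δ σ} → Absorbs δ σ → ∀ P → weight δ (subP σ P) ≡ weight δ P
weight-subP δσ≡δ []             = refl
weight-subP δσ≡δ ((s , t) ∷ P) =
  cong₂ _+_ (cong₂ _+_ (cong size (absorbs-subT δσ≡δ s)) (cong size (absorbs-subT δσ≡δ t)))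
            (weight-subP δσ≡δ P)

weight-tail : ∀ δ s t P {n} → weight δ ((s , t) ∷ P) < suc n → weight δ P < n
weight-tail δ s t P lt =
  ≤-trans (+-monoˡ-≤ (weight δ P) (≤-trans (size-pos (subT δ s)) (m≤m+n _ _))) (≤-pred lt)

weight-decompose : ∀ δ f s t ss ts P {n} →
  weight δ ((fun f (s ∷ ss) , fun f (t ∷ ts)) ∷ P) < suc n →
  weight δ ((s , t) ∷ (fun f ss , fun f ts) ∷ P) < n
weight-decompose δ f s t ss ts P {n} lt =
  ≤-trans (n≤1+n _) (≤-pred (subst (_< suc n) (regroup (size (subT δ s)) (size (subT δ t)) (sizes (subTs δ ss)) (sizes (subTs δ ts)) (weight δ P)) lt))
  where
    regroup : ∀ a b c d w →
      suc (suc (a + c)) + suc (suc (b + d)) + w ≡ suc (suc (a + b + (suc c + suc d + w)))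
    regroup = solve-∀

-- Robinson's unification, run on a problem known to have the unifier δ; each call
-- decreases the size of the δ-image of the problem, which bounds the recursion.
mutual
  unify : ∀ n δ P → Unifier δ P → weight δ P < n → MostGeneralUnifier P
  unify (suc n) δ []                          _       _  = mgu-[]
  unify (suc n) δ ((var x , t) ∷ P)           (e ∷ u) lt =
    unify-var n δ x t P e u (weight-tail δ (var x) t P lt)
  unify (suc n) δ ((fun f ss , var y) ∷ P)    (e ∷ u) lt =
    mgu-swap (unify-var n δ y (fun f ss) P (sym e) u (weight-tail δ (fun f ss) (var y) P lt))
  unify (suc n) δ ((fun f ss , fun g ts) ∷ P) (e ∷ u) lt with fun-injective e
  ... | refl , δss≡δts = unify-args n δ f ss ts P δss≡δts u lt

  unify-var : ∀ n δ x t P → δ x ≡ subT δ t → Unifier δ P → weight δ P < n →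
              MostGeneralUnifier ((var x , t) ∷ P)
  unify-var n δ x t P δx≡δt u lt with x ∈? varsT t
  ... | yes x∈t =
    subst (λ t → MostGeneralUnifier ((var x , t) ∷ P)) (sym (occurs-check δ t x∈t δx≡δt))
          (mgu-trivial (var x) (unify n δ P u lt))
  ... | no x∉t =
    mgu-eliminate x∉t (unify n δ (subP (x ↦ t) P) (unifier-subP δ↦ P u)
                             (subst (_< n) (sym (weight-subP δ↦ P)) lt))
    where δ↦ = absorbs-↦ δx≡δt

  unify-args : ∀ n δ f ss ts P → subTs δ ss ≡ subTs δ ts → Unifier δ P →
               weight δ ((fun f ss , fun f ts) ∷ P) < suc n →
               MostGeneralUnifier ((fun f ss , fun f ts) ∷ P)
  unify-args n δ f []       []       P _  u lt =
    mgu-trivial (fun f []) (unify n δ P u (weight-tail δ (fun f []) (fun f []) P lt))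
  unify-args n δ f []       (_ ∷ _)  P () u lt
  unify-args n δ f (_ ∷ _)  []       P () u lt
  unify-args n δ f (s ∷ ss) (t ∷ ts) P δs∷δss≡δt∷δts u lt =
    let (e , es) = ∷-injective δs∷δss≡δt∷δts
    in mgu-decompose (unify n δ _ (e ∷ cong (fun f) es ∷ u) (weight-decompose δ f s t ss ts P lt))

atomTerm : Atom → Term
atomTerm (atom P ts) = fun P ts

unifies⇒solves : ∀ σ A B → Unifies σ A B → Solves σ (atomTerm A , atomTerm B)
unifies⇒solves σ (atom P ts) (atom Q us) = cong atomTerm

solves⇒unifies : ∀ σ A B → Solves σ (atomTerm A , atomTerm B) → Unifies σ A B
solves⇒unifies σ (atom P ts) (atom Q us) e with fun-injective e
... | refl , σts≡σus = cong (atom P) σts≡σus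

mgu-atoms : ∀ δ A B → Unifies δ A B →
  Σ Subst (λ γ → MGU γ A B × (∀ δ' → Unifies δ' A B → Absorbs δ' γ))
mgu-atoms δ A B δAB =
  γ , (solves⇒unifies γ A B γAB , λ δ' δ'AB → δ' , λ x → sym (most-general δ' δ'AB x)) ,
  most-general
  where
    problem = (atomTerm A , atomTerm B) ∷ []
    result = unify _ δ problem (unifies⇒solves δ A B δAB ∷ []) (n<1+n _)
    γ = proj₁ result
    γAB = All.head (proj₁ (proj₂ result))
    most-general : ∀ δ' → Unifies δ' A B → Absorbs δ' γ
    most-general δ' δ'AB = proj₂ (proj₂ result) δ' (unifies⇒solves δ' A B δ'AB ∷ [])

glue : ℕ → Subst → Subst → Subst
glue N δ θ y with y <? N
... | yes _ = δ y
... | no  _ = θ (y ∸ N)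

glue-below : ∀ {N δ θ y} → y < N → glue N δ θ y ≡ δ y
glue-below {N} {y = y} y<N with y <? N
... | yes _  = refl
... | no y≮N = ⊥-elim (y≮N y<N)

glue-above : ∀ N δ θ x → glue N δ θ (N + x) ≡ θ x
glue-above N δ θ x with N + x <? N
... | yes N+x<N = ⊥-elim (m+n≮m N x N+x<N)
... | no  _     = cong θ (m+n∸m≡n N x)

bound : List Atom → ℕ
bound G = suc (max 0 (varsAs G))

bound-fresh : ∀ G {x} → x ∈ varsAs G → x < bound G
bound-fresh G x∈ = s≤s (All.lookup (xs≤max 0 (varsAs G)) x∈)

module _ (Φ : Program) where

  data Derivation : Atom → Set where
    node : ∀ {c Bs C A} → (c , (Bs ⇒ C)) ∈ Φ → (θ : Subst) →
           All Derivation (subAs θ Bs) → subA θ C ≡ A → Derivation A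

  mutual
    nodes : ∀ {A} → Derivation A → ℕ
    nodes (node _ _ ds _) = suc (nodesAll ds)

    nodesAll : ∀ {As} → All Derivation As → ℕ
    nodesAll []       = 0
    nodesAll (d ∷ ds) = nodes d + nodesAll ds

  nodesAll-++ : ∀ {As Bs} (ds : All Derivation As) (es : All Derivation Bs) →
                nodesAll (++⁺ ds es) ≡ nodesAll ds + nodesAll es
  nodesAll-++ []       es = refl
  nodesAll-++ (d ∷ ds) es = trans (cong (nodes d +_) (nodesAll-++ ds es)) (sym (+-assoc (nodes d) _ _))

  Valid : Horn → Set
  Valid F = ∀ θ → All Derivation (subAs θ (body F)) → Derivation (subA θ (head F))

  horn : Formula → Horn
  horn (plain F)  = F
  horn (closed F) = F

  sound : ∀ {e F} → Φ ⊢ e ∶ F → Valid (horn F)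
  sound (axiom c∈Φ) θ ds = node c∈Φ θ ds refl
  sound (gen d)          = sound d
  sound (inst σ d) θ ds  =
    subst Derivation (sym (subA-∘ θ σ _)) (sound d (θ · σ) (subst (All Derivation) (subAs-∘ θ σ _) ds))
  sound (cut {As = As} {Bs} {D} _ _ _ _ _ d₁ d₂) θ ds
    with ++⁻ (subAs θ As) (subst (All Derivation) (map-++ (subA θ) As Bs) ds)
  ... | dsA , dsB =
    sound d₂ θ (subst (All Derivation) (sym (map-++ (subA θ) Bs (D ∷ []))) (++⁺ dsB (sound d₁ θ dsA ∷ [])))

  lifting : ∀ {c Bs C} Ai G₂ γ' δ → (c , (Bs ⇒ C)) ∈ Φ → (θ : Subst) → subA θ C ≡ subA δ Ai →
            Σ[ G' ∈ List Atom ] Σ[ γ ∈ Subst ] Σ[ δ' ∈ Subst ]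
              Step Φ (Ai ∷ G₂) γ' G' (γ · γ') × subAs δ' G' ≡ subAs θ Bs ++ subAs δ G₂
  lifting {Bs = Bs} {C} Ai G₂ γ' δ c∈Φ θ θC≡δAi =
    subAs γ L , γ , δ' , step [] G₂ Ai γ' γ ρ c∈Φ renamed-apart mgu , δ'-instance
    where
      N = bound (Ai ∷ G₂)
      ρ : ℕ → ℕ
      ρ = N +_
      δ' = glue N δ θ
      L = subAs (ren ρ) Bs ++ G₂

      δ'-on-goals : ∀ x → x ∈ varsAs (Ai ∷ G₂) → δ' x ≡ δ x
      δ'-on-goals x x∈ = glue-below (bound-fresh (Ai ∷ G₂) x∈)

      renamed-apart : RenamedApart ρ (Bs ⇒ C) (Ai ∷ G₂)
      renamed-apart = +-cancelˡ-≡ N , All.tabulate (λ {x} _ ρx∈ → m+n≮m N x (bound-fresh (Ai ∷ G₂) ρx∈))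

      unifies : Unifies δ' (subA (ren ρ) C) Ai
      unifies = begin
        subA δ' (subA (ren ρ) C)  ≡⟨ subA-∘ δ' (ren ρ) C ⟩
        subA (δ' · ren ρ) C       ≡⟨ subA-cong _ θ C (glue-above N δ θ) ⟩
        subA θ C                  ≡⟨ θC≡δAi ⟩
        subA δ Ai                 ≡⟨ subA-cong-vars δ' δ Ai (λ x x∈ → δ'-on-goals x (∈-++⁺ˡ x∈)) ⟨
        subA δ' Ai                ∎

      resolution = mgu-atoms δ' (subA (ren ρ) C) Ai unifies
      γ = proj₁ resolution
      mgu = proj₁ (proj₂ resolution)
      δ'-absorbs-γ = proj₂ (proj₂ resolution) δ' unifies

      δ'-instance : subAs δ' (subAs γ L) ≡ subAs θ Bs ++ subAs δ G₂
      δ'-instance = begin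
        subAs δ' (subAs γ L)                          ≡⟨ subAs-∘ δ' γ L ⟩
        subAs (δ' · γ) L                              ≡⟨ subAs-cong _ δ' L δ'-absorbs-γ ⟩
        subAs δ' L                                    ≡⟨ map-++ (subA δ') (subAs (ren ρ) Bs) G₂ ⟩
        subAs δ' (subAs (ren ρ) Bs) ++ subAs δ' G₂    ≡⟨ cong₂ _++_ (subAs-∘ δ' (ren ρ) Bs) on-G₂ ⟩
        subAs (δ' · ren ρ) Bs ++ subAs δ G₂           ≡⟨ cong (_++ subAs δ G₂) (subAs-cong _ θ Bs (glue-above N δ θ)) ⟩
        subAs θ Bs ++ subAs δ G₂                      ∎
        where
          on-G₂ = subAs-cong-vars δ' δ G₂ (λ x x∈ → δ'-on-goals x (∈-++⁺ʳ (varsA Ai) x∈))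

  refute : ∀ n G γ' δ {Hs} → Hs ≡ subAs δ G → (ds : All Derivation Hs) → nodesAll ds < n →
           Σ Subst (λ γ → Steps Φ G γ' [] γ)
  refute (suc n) []        γ' δ _   _                           _  = γ' , done
  refute (suc n) (Ai ∷ G₂) γ' δ Hs≡ (node c∈Φ θ bs θC≡H ∷ ds) lt
    with ∷-injective Hs≡
  ... | H≡δAi , Hs₂≡δG₂ with lifting Ai G₂ γ' δ c∈Φ θ (trans θC≡H H≡δAi)
  ... | G' , γ , δ' , resolve , δ'G'≡ =
    map₂ (more resolve)
      (refute n G' (γ · γ') δ' (trans (cong (subAs θ _ ++_) Hs₂≡δG₂) (sym δ'G'≡)) (++⁺ bs ds)
              (subst (_< n) (sym (nodesAll-++ bs ds)) (≤-pred lt)))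

  refutation-complete : ∀ δ G → All Derivation (subAs δ G) → Σ Subst (λ γ → Φ ⊢ G ↝*[ γ ] [])
  refutation-complete δ G ds = refute (suc (nodesAll ds)) G ε δ refl ds ≤-refl

theorem7 : (Φ : Program) → DistinctLabels Φ → (A : Atom) → (n : PTerm) →
    Normal n → (Φ ⊢ n ∶ plain ([] ⇒ A)) ⊎ (Φ ⊢ n ∶ closed ([] ⇒ A)) →
    Σ Subst (λ γ → Φ ⊢ (A ∷ []) ↝*[ γ ] [])
theorem7 Φ _ A _ _ typing = refutation-complete Φ ε (A ∷ []) (valid ε [] ∷ [])
  where
    valid : Valid Φ ([] ⇒ A)
    valid = [ sound Φ , sound Φ ]′ typing
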